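{- Let $p$ be a prime and let $P,Q\in(\mathbb{Z}/p\mathbb{Z})[\boldsymbol{x}^{\pm1}]$ be Laurent polynomials in $\boldsymbol{x}=(x_1,\dots,x_d)$, and let $\operatorname{dg}$ be any degree-like function. Running the state-construction procedure described in the context (in its linear, automatic, or scaling variant) modulo $p$ starting from $(P,Q)$ yields states of the form $A_i(n)=\operatorname{ct}[P(\boldsymbol{x})^nQ_i(\boldsymbol{x})]$ with $$\operatorname{dg}(Q_i)\le\max(\operatorname{dg}(P)-1,\operatorname{dg}(Q)).$$
   Context: Here $R=\mathbb{Z}/p\mathbb{Z}$. For a Laurent polynomial $F=\sum_{\boldsymbol{k}\in\mathbb{Z}^d}a_{\boldsymbol{k}}\boldsymbol{x}^{\boldsymbol{k}}$, $\operatorname{ct}[F]=a_{\boldsymbol{0}}$, and $\Lambda_p\big[\sum_{\boldsymbol{k}}a_{\boldsymbol{k}}\boldsymbol{x}^{\boldsymbol{k}}\big]=\sum_{\boldsymbol{k}}a_{p\boldsymbol{k}}\boldsymbol{x}^{\boldsymbol{k}}$. A degree-like function is a map $\operatorname{dg}:R[\boldsymbol{x}^{\pm1}]\to\mathbb{Z}_{\ge0}$ with $\operatorname{dg}(FG)\le\operatorname{dg}(F)+\operatorname{dg}(G)$ and $\operatorname{dg}(\Lambda_p[F])\le\operatorname{dg}(F)/p$. A linear $p$-scheme for $A:\mathbb{Z}_{\ge0}\to R$ consists of states $A_0=A,\dots,A_m$ with $A_i(pn+k)=\sum_j\alpha^{(k)}_{i,j}A_j(n)$ for all $i$, $k\in\{0,\dots,p-1\}$,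 $n\ge0$; it is automatic if each right-hand side is $0$ or a single $A_j(n)$, and scaling if each right-hand side has at most one nonzero term. State-construction procedure: states are pairs $(P_i,Q_i)$ representing $A_i(n)=\operatorname{ct}[P_i^nQ_i]$, starting with $(P_0,Q_0)=(P,Q)$. For each state $i$ and $k\in\{0,\dots,p-1\}$, set $\tilde P=P_i^p$, $\tilde Q=P_i^kQ_i$; if $\tilde P(\boldsymbol{x})=\hat P(\boldsymbol{x}^p)$ for some Laurent polynomial $\hat P$, set $\hat Q=\Lambda_p[\tilde Q]$, otherwise $\hat P=\tilde P,\hat Q=\tilde Q$. Then $A_i(pn+k)=\operatorname{ct}[\hat P^n\hat Q]$. In the linear (resp. automatic, resp. scaling) variant one checks whether this is an $R$-linear combination of (resp. equal to, resp. an $R$-multiple of) existing states of the form $\operatorname{ct}[\hat P^nQ_j]$, recording the transition if so and adding $(\hat P,\hat Q)$ as a new state otherwise, until all states and all $k$ are processed. -}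

module Defs where

open import Data.Nat using (ℕ; zero; suc; _≤_; _<_; _⊔_; _∸_)
import Data.Nat as ℕ
open import Data.Integer using (ℤ; +_; _+_; _-_; _*_)
open import Data.Integer.Divisibility using (_∣_)
open import Data.Integer.DivMod using (_/ℕ_; _%ℕ_)
open import Data.List using (List; []; _∷_; map; concatMap)
open import Data.Vec using (Vec; replicate; zipWith)
import Data.Vec as Vec
open import Data.Vec.Properties using (≡-dec)
open import Data.Bool using (Bool; true; false; _∧_)
open import Data.Product using (_×_; _,_; Σ)
open import Relation.Nullary using (¬_; yes; no)
open import Relation.Binary.PropositionalEquality using (_≡_)
import Data.Integer as Int

-- Coefficients are integers
-- read modulo p; equality in (ℤ/pℤ)[x^{±1}] is the setoid _≈[ p ]_ below.
LPoly : ℕ → Set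
LPoly d = List (ℤ × Vec ℤ d)

module _ {d : ℕ} where

  coeff : LPoly d → Vec ℤ d → ℤ
  coeff [] e = + 0
  coeff ((c , k) ∷ F) e with ≡-dec Int._≟_ k e
  ... | yes _ = c + coeff F e
  ... | no  _ = coeff F e

  _≈[_]_ : LPoly d → ℕ → LPoly d → Set
  F ≈[ p ] G = ∀ e → (+ p) ∣ (coeff F e - coeff G e)

  oneL : LPoly d
  oneL = (+ 1 , replicate d (+ 0)) ∷ []

  _*L_ : LPoly d → LPoly d → LPoly d
  F *L G = concatMap (λ { (c , k) → map (λ { (c' , k') → (c * c' , zipWith _+_ k k') }) G }) F

  _^L_ : LPoly d → ℕ → LPoly d
  F ^L zero = oneL
  F ^L suc n = F *L (F ^L n)

  ct : LPoly d → ℤ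
  ct F = coeff F (replicate d (+ 0))

  frob : ℕ → LPoly d → LPoly d
  frob p = map (λ { (c , k) → (c , Vec.map (λ e → + p * e) k) })

  -- Λ_p : keeps the terms whose exponent vector lies in pℤ^d and divides it by p.
  -- (For p = 0, which never occurs since p is prime, it is the identity.)
  Λ : ℕ → LPoly d → LPoly d
  Λ zero F = F
  Λ (suc q) [] = []
  Λ (suc q) ((c , k) ∷ F) with allDiv k
    where
      allDiv : ∀ {m} → Vec ℤ m → Bool
      allDiv Vec.[] = true
      allDiv (e Vec.∷ es) with e %ℕ suc q
      ... | zero  = allDiv es
      ... | suc _ = false
  ... | true  = (c , Vec.map (λ e → e /ℕ suc q) k) ∷ Λ (suc q) F
  ... | false = Λ (suc q) F

-- The condition dg(Λ_p F) ≤ dg(F)/p is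
-- written (equivalently, as p > 0) as dg(Λ_p F) * p ≤ dg(F).
record DegreeLike (p d : ℕ) : Set where
  field
    dg      : LPoly d → ℕ
    dg-resp : ∀ {F G} → F ≈[ p ] G → dg F ≡ dg G
    dg-mul  : ∀ F G → dg (F *L G) ≤ dg F ℕ.+ dg G
    dg-Λ    : ∀ F → dg (Λ p F) ℕ.* p ≤ dg F

-- Every state added by the linear, automatic or scaling variant is obtained
-- from an existing state (P_i,Q_i) and some k < p by the step below, so the
-- states of any variant are among the pairs satisfying Reachable.
data Reachable {d : ℕ} (p : ℕ) (P Q : LPoly d) : LPoly d → LPoly d → Set where
  start   : Reachable p P Q P Q
  stepSub : ∀ {Pi Qi} → Reachable p P Q Pi Qi → (k : ℕ) → k < p →
            (P̂ : LPoly d) → (Pi ^L p) ≈[ p ] frob p P̂ →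
            Reachable p P Q P̂ (Λ p ((Pi ^L k) *L Qi))
  stepKeep : ∀ {Pi Qi} → Reachable p P Q Pi Qi → (k : ℕ) → k < p →
            ¬ (Σ (LPoly d) λ P̂ → (Pi ^L p) ≈[ p ] frob p P̂) →
            Reachable p P Q (Pi ^L p) ((Pi ^L k) *L Qi)

-- Over 𝔽_p the Frobenius identity F(x)^p = F(x^p) holds for every Laurent
-- polynomial F: it follows from the freshman's dream (x + y)^p = x^p + y^p,
-- valid in any commutative semiring of characteristic p because p divides the
-- middle binomial coefficients, together with Fermat's c^p = c for the
-- coefficients.  Since F ↦ F(x^p) is injective, every state (P_i, Q_i) of the
-- procedure has P_i = P and always takes the Λ_p branch.  For the new
-- Q̂ = Λ_p[P^k Q_i] with k ≤ p - 1 this gives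
--   p · dg(Q̂) ≤ dg(P^k Q_i) ≤ (p - 1)(M + 1) + M < p (M + 1)
-- whenever dg(P) ≤ M + 1 and dg(Q_i) ≤ M, so the bound
-- M = max(dg(P) - 1, dg(Q)) is invariant.
module Submission where

open import Defs
open import Algebra.Bundles using (CommutativeSemiring)
open import Algebra.Structures.Biased using (isCommutativeSemiringˡ; isCommutativeMonoidˡ)
open import Data.Empty using (⊥-elim)
open import Data.Fin.Base as Fin using (toℕ; fromℕ; inject₁)
import Data.Fin.Properties as Finₚ
open import Data.Integer.Base as ℤ using (ℤ; +_; 0ℤ; 1ℤ)
import Data.Integer.Properties as ℤ
open import Data.Integer.Divisibility using (_∣_)
import Data.Integer.Divisibility.Signed as Signed
open import Data.Integer.DivMod using (_/ℕ_; _%ℕ_; a≡a%ℕn+[a/ℕn]*n)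
open import Data.Integer.Tactic.RingSolver using (solve-∀)
open import Data.List.Base using (List; []; _∷_; [_]; _++_; map; concatMap)
import Data.List.Properties as List
open import Data.Nat.Base as ℕ using (ℕ; zero; suc; _∸_; _<_; _≤_; _⊔_; _!; z<s; s<s)
import Data.Nat.Properties as ℕ
open import Data.Nat.Combinatorics using (_C_; nCn≡1; nCk≡n!/k![n-k]!; k![n∸k]!∣n!)
open import Data.Nat.Divisibility as ℕ using (_∤_; divides; m∣m*n; >⇒∤)
open import Data.Nat.DivMod using (m/n*n≡m)
open import Data.Nat.Primality using (Prime; euclidsLemma; ¬prime[0]; prime⇒nonTrivial; prime⇒nonZero)
open import Data.Product using (_×_; _,_; proj₁; proj₂)
open import Data.Sum using (inj₁; inj₂; [_,_]′)
open import Data.Vec.Base as Vec using (Vec; zipWith; replicate)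
open import Data.Vec.Properties using (≡-dec; ∷-injectiveˡ; ∷-injectiveʳ)
open import Data.Vec.Relation.Binary.Pointwise.Inductive
  using (Pointwise-≡⇒≡; zipWith-comm; zipWith-assoc; zipWith-identityˡ)
open import Function.Base using (_$_)
open import Level using (0ℓ)
open import Relation.Binary.PropositionalEquality as ≡ using (_≡_; refl; cong; cong₂; sym; trans)
open import Relation.Binary.Bundles using (Setoid)
open import Relation.Binary.Structures using (IsEquivalence)
open import Relation.Nullary using (yes; no)

-- Binomial coefficients modulo a prime

nCk*k![n∸k]!≡n! : ∀ {n k} → k ≤ n → (n C k) ℕ.* (k ! ℕ.* (n ∸ k) !) ≡ n !
nCk*k![n∸k]!≡n! {n} {k} k≤n = trans (cong (ℕ._* (k ! ℕ.* (n ∸ k) !)) (nCk≡n!/k![n-k]! k≤n))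
  (m/n*n≡m {{ℕ.m*n≢0 (k !) ((n ∸ k) !) {{k ℕ.!≢0}} {{(n ∸ k) ℕ.!≢0}}}} (k![n∸k]!∣n! k≤n))

prime∤! : ∀ {p m} → Prime p → m < p → p ∤ m !
prime∤! {p} {zero}  pr _   = >⇒∤ (ℕ.nonTrivial⇒n>1 p {{prime⇒nonTrivial pr}})
prime∤! {p} {suc m} pr m<p p∣[1+m]! with euclidsLemma (suc m) (m !) pr p∣[1+m]!
... | inj₁ p∣1+m = >⇒∤ m<p p∣1+m
... | inj₂ p∣m!  = prime∤! pr (ℕ.<-trans (ℕ.n<1+n m) m<p) p∣m!

prime∣pCk : ∀ {p k} → Prime p → 0 < k → k < p → p ℕ.∣ p C k
prime∣pCk {suc q} {k} pr 0<k k<p with euclidsLemma (suc q C k) (k ! ℕ.* (suc q ∸ k) !) pr p∣p!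
  where
  p∣p! : suc q ℕ.∣ (suc q C k) ℕ.* (k ! ℕ.* (suc q ∸ k) !)
  p∣p! = ≡.subst (suc q ℕ.∣_) (sym (nCk*k![n∸k]!≡n! (ℕ.<⇒≤ k<p))) (m∣m*n (q !))
... | inj₁ p∣pCk = p∣pCk
... | inj₂ p∣k![p∸k]! = ⊥-elim ([ prime∤! pr k<p , prime∤! pr (ℕ.∸-monoʳ-< 0<k (ℕ.<⇒≤ k<p)) ]′
                                  (euclidsLemma (k !) ((suc q ∸ k) !) pr p∣k![p∸k]!))

-- Commutative semirings of prime characteristic

module Characteristic {c ℓ} (S : CommutativeSemiring c ℓ) where

  open CommutativeSemiring S hiding (zero; sym) renaming (refl to ≈-refl; trans to ≈-trans)
  open import Algebra.Properties.Semiring.Exp semiring using (_^_)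
  open import Algebra.Properties.Semiring.Mult semiring
    using (×-assoc-*; ×-congʳ; ×-assocˡ) renaming (_×_ to _·_)
  open import Algebra.Properties.Semiring.Sum semiring
    using (sum; sum-cong-≋; sum-replicate-zero; sum-init-last)
  open import Algebra.Properties.CommutativeSemiring.Binomial S using (theorem; binomialTerm)
  open import Relation.Binary.Reasoning.Setoid setoid

  1#^≈1# : ∀ n → 1# ^ n ≈ 1#
  1#^≈1# zero    = ≈-refl
  1#^≈1# (suc n) = ≈-trans (*-identityˡ (1# ^ n)) (1#^≈1# n)

  ·1#≈0#⇒·≈0# : ∀ {p} → p · 1# ≈ 0# → ∀ x → p · x ≈ 0#
  ·1#≈0#⇒·≈0# {p} p·1≈0 x = begin
    p · x          ≈⟨ ×-congʳ p (*-identityˡ x) ⟨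
    p · (1# * x)   ≈⟨ ×-assoc-* p 1# x ⟨
    (p · 1#) * x   ≈⟨ *-congʳ p·1≈0 ⟩
    0# * x         ≈⟨ zeroˡ x ⟩
    0#             ∎

  freshman's-dream : ∀ {p} → Prime p → p · 1# ≈ 0# → ∀ x y → (x + y) ^ p ≈ x ^ p + y ^ p
  freshman's-dream {zero}  pr = ⊥-elim (¬prime[0] pr)
  freshman's-dream {suc q} pr p·1≈0 x y = begin
    (x + y) ^ p
      ≈⟨ theorem p x y ⟩
    t Fin.zero + sum (λ i → t (Fin.suc i))
      ≈⟨ +-congˡ (sum-init-last (λ i → t (Fin.suc i))) ⟩
    t Fin.zero + (sum (λ i → t (Fin.suc (inject₁ i))) + t (Fin.suc (fromℕ q)))
      ≈⟨ +-cong first (+-cong (≈-trans (sum-cong-≋ middle) (sum-replicate-zero q)) last) ⟩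
    y ^ p + (0# + x ^ p)
      ≈⟨ +-comm _ _ ⟩
    (0# + x ^ p) + y ^ p
      ≈⟨ +-congʳ (+-identityˡ _) ⟩
    x ^ p + y ^ p
      ∎
    where
    p = suc q
    t = binomialTerm x y p

    first : t Fin.zero ≈ y ^ p
    first = ≈-trans (+-identityʳ _) (*-identityˡ _)

    middle : ∀ i → t (Fin.suc (inject₁ i)) ≈ 0#
    middle i with prime∣pCk pr z<s (s<s (≡.subst (_< q) (sym (Finₚ.toℕ-inject₁ i)) (Finₚ.toℕ<n i)))
    ... | divides m pCj≡m*p = begin
      (p C j) · b        ≡⟨ cong (_· b) (trans pCj≡m*p (ℕ.*-comm m p)) ⟩
      (p ℕ.* m) · b      ≈⟨ ×-assocˡ b p m ⟨
      p · (m · b)        ≈⟨ ·1#≈0#⇒·≈0# {p} p·1≈0 (m · b) ⟩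
      0#                 ∎
      where
      j = suc (toℕ (inject₁ i))
      b = x ^ j * y ^ (p ∸ j)

    last : t (Fin.suc (fromℕ q)) ≈ x ^ p
    last = begin
      t (Fin.suc (fromℕ q))
        ≡⟨ cong (λ j → (p C suc j) · (x ^ suc j * y ^ (p ∸ suc j))) (Finₚ.toℕ-fromℕ q) ⟩
      (p C p) · (x ^ p * y ^ (p ∸ p))
        ≡⟨ cong₂ (λ a b → a · (x ^ p * y ^ b)) (nCn≡1 p) (ℕ.n∸n≡0 p) ⟩
      1 · (x ^ p * 1#)                 ≈⟨ +-identityʳ _ ⟩
      x ^ p * 1#                       ≈⟨ *-identityʳ _ ⟩
      x ^ p                            ∎

  fermat : ∀ {p} → Prime p → p · 1# ≈ 0# → ∀ n → (n · 1#) ^ p ≈ n · 1#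
  fermat {zero}  pr = ⊥-elim (¬prime[0] pr)
  fermat {suc q} pr p·1≈0 zero    = zeroˡ _
  fermat {suc q} pr p·1≈0 (suc n) = begin
    (1# + n · 1#) ^ suc q             ≈⟨ freshman's-dream pr p·1≈0 1# (n · 1#) ⟩
    1# ^ suc q + (n · 1#) ^ suc q     ≈⟨ +-cong (1#^≈1# (suc q)) (fermat pr p·1≈0 n) ⟩
    1# + n · 1#                       ∎

-- Congruence modulo m on ℤ

open import Data.Integer.Base using (_+_; _-_; _*_; _^_)

infix 4 _≡_[mod_]

-- A record rather than a definition, so that a and b are inferable from a proof.
record _≡_[mod_] (a b : ℤ) (m : ℕ) : Set where
  constructor from∣
  field to∣ : + m ∣ a - b

open _≡_[mod_] public

module _ {m : ℕ} where

  private
    via-signed : ∀ a b {x} → x ≡ a - b → + m Signed.∣ x → a ≡ b [mod m ]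
    via-signed _ _ x≡a-b m∣x = from∣ (Signed.∣⇒∣ᵤ (≡.subst (_ Signed.∣_) x≡a-b m∣x))

    signed : ∀ a b → a ≡ b [mod m ] → + m Signed.∣ a - b
    signed _ _ a≡b = Signed.∣ᵤ⇒∣ (to∣ a≡b)

  ≡⇒≡[mod] : ∀ {a b} → a ≡ b → a ≡ b [mod m ]
  ≡⇒≡[mod] {a} refl = via-signed a a (sym (ℤ.+-inverseʳ a)) (Signed.∣n⇒∣m*n 0ℤ Signed.∣-refl)

  ≡[mod]-refl : ∀ {a} → a ≡ a [mod m ]
  ≡[mod]-refl = ≡⇒≡[mod] refl

  ≡[mod]-sym : ∀ {a b} → a ≡ b [mod m ] → b ≡ a [mod m ]
  ≡[mod]-sym {a} {b} a≡b = via-signed b a (eq a b) (Signed.∣m⇒∣-m (signed a b a≡b))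
    where
    eq : ∀ a b → ℤ.- (a - b) ≡ b - a
    eq = solve-∀

  ≡[mod]-trans : ∀ {a b c} → a ≡ b [mod m ] → b ≡ c [mod m ] → a ≡ c [mod m ]
  ≡[mod]-trans {a} {b} {c} a≡b b≡c =
    via-signed a c (ℤ.+-minus-telescope a b c)
      (Signed.∣m∣n⇒∣m+n (signed a b a≡b) (signed b c b≡c))

  ≡[mod]-isEquivalence : IsEquivalence _≡_[mod m ]
  ≡[mod]-isEquivalence = record { refl = ≡[mod]-refl ; sym = ≡[mod]-sym ; trans = ≡[mod]-trans }

  +-cong[mod] : ∀ {a a′ b b′} → a ≡ a′ [mod m ] → b ≡ b′ [mod m ] → a + b ≡ a′ + b′ [mod m ]
  +-cong[mod] {a} {a′} {b} {b′} a≡a′ b≡b′ =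
    via-signed (a + b) (a′ + b′) (eq a a′ b b′)
      (Signed.∣m∣n⇒∣m+n (signed a a′ a≡a′) (signed b b′ b≡b′))
    where
    eq : ∀ a a′ b b′ → (a - a′) + (b - b′) ≡ (a + b) - (a′ + b′)
    eq = solve-∀

  *-cong[mod] : ∀ {a a′ b b′} → a ≡ a′ [mod m ] → b ≡ b′ [mod m ] → a * b ≡ a′ * b′ [mod m ]
  *-cong[mod] {a} {a′} {b} {b′} a≡a′ b≡b′ =
    via-signed (a * b) (a′ * b′) (eq a a′ b b′)
      (Signed.∣m∣n⇒∣m+n (Signed.∣m⇒∣m*n b (signed a a′ a≡a′)) (Signed.∣n⇒∣m*n a′ (signed b b′ b≡b′)))
    where
    eq : ∀ a a′ b b′ → (a - a′) * b + a′ * (b - b′) ≡ a * b - a′ * b′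
    eq = solve-∀

  *+m≡0[mod] : ∀ k → k * + m ≡ 0ℤ [mod m ]
  *+m≡0[mod] k = via-signed (k * + m) 0ℤ (sym (ℤ.+-identityʳ _)) (Signed.∣n⇒∣m*n k Signed.∣-refl)

ℤ/_ : ℕ → CommutativeSemiring 0ℓ 0ℓ
ℤ/ m = record
  { Carrier = ℤ ; _≈_ = _≡_[mod m ] ; _+_ = _+_ ; _*_ = _*_ ; 0# = 0ℤ ; 1# = 1ℤ
  ; isCommutativeSemiring = isCommutativeSemiringˡ record
    { +-isCommutativeMonoid = isCommutativeMonoidˡ record
      { isSemigroup = record
        { isMagma = record { isEquivalence = ≡[mod]-isEquivalence ; ∙-cong = +-cong[mod] }
        ; assoc   = λ a b c → ≡⇒≡[mod] (ℤ.+-assoc a b c) }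
      ; identityˡ = λ a → ≡⇒≡[mod] (ℤ.+-identityˡ a)
      ; comm      = λ a b → ≡⇒≡[mod] (ℤ.+-comm a b) }
    ; *-isCommutativeMonoid = isCommutativeMonoidˡ record
      { isSemigroup = record
        { isMagma = record { isEquivalence = ≡[mod]-isEquivalence ; ∙-cong = *-cong[mod] }
        ; assoc   = λ a b c → ≡⇒≡[mod] (ℤ.*-assoc a b c) }
      ; identityˡ = λ a → ≡⇒≡[mod] (ℤ.*-identityˡ a)
      ; comm      = λ a b → ≡⇒≡[mod] (ℤ.*-comm a b) }
    ; distribʳ = λ a b c → ≡⇒≡[mod] (ℤ.*-distribʳ-+ a b c)
    ; zeroˡ    = λ a → ≡⇒≡[mod] (ℤ.*-zeroˡ a) } }

module _ {p : ℕ} where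

  open CommutativeSemiring (ℤ/ p) using (setoid; semiring)
  open import Algebra.Properties.Semiring.Exp semiring using (^-congˡ) renaming (_^_ to _^ₚ_)
  open import Algebra.Properties.Semiring.Mult semiring using () renaming (_×_ to _·_)
  open Characteristic (ℤ/ p) using (fermat)
  open import Relation.Binary.Reasoning.Setoid setoid

  private
    ·1≡+ : ∀ n → n · 1ℤ ≡ + n
    ·1≡+ zero    = refl
    ·1≡+ (suc n) = cong (_+_ 1ℤ) (·1≡+ n)

    ^ₚ≡^ : ∀ c n → c ^ₚ n ≡ c ^ n
    ^ₚ≡^ c zero    = refl
    ^ₚ≡^ c (suc n) = cong (c *_) (^ₚ≡^ c n)

  fermat-ℤ : Prime p → ∀ c → c ^ p ≡ c [mod p ]
  fermat-ℤ pr c = begin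
    c ^ p           ≡⟨ ^ₚ≡^ c p ⟨
    c ^ₚ p          ≈⟨ ^-congˡ p c≡r ⟩
    (+ r) ^ₚ p      ≡⟨ cong (_^ₚ p) (·1≡+ r) ⟨
    (r · 1ℤ) ^ₚ p   ≈⟨ fermat pr p·1≡0 r ⟩
    r · 1ℤ          ≡⟨ ·1≡+ r ⟩
    + r             ≈⟨ ≡[mod]-sym c≡r ⟩
    c               ∎
    where
    instance _ = prime⇒nonZero pr
    r = c %ℕ p

    p·1≡0 : p · 1ℤ ≡ 0ℤ [mod p ]
    p·1≡0 = ≡.subst (_≡ 0ℤ [mod p ]) (trans (ℤ.*-identityˡ (+ p)) (sym (·1≡+ p))) (*+m≡0[mod] 1ℤ)

    c≡r : c ≡ + r [mod p ]
    c≡r = begin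
      c                      ≡⟨ a≡a%ℕn+[a/ℕn]*n c p ⟩
      + r + (c /ℕ p) * + p   ≈⟨ +-cong[mod] (≡[mod]-refl {a = + r}) (*+m≡0[mod] (c /ℕ p)) ⟩
      + r + 0ℤ               ≡⟨ ℤ.+-identityʳ (+ r) ⟩
      + r                    ∎

-- Coefficients of Laurent polynomials

private variable
  A B : Set
  d : ℕ

∑ : List A → (A → ℤ) → ℤ
∑ []       f = 0ℤ
∑ (x ∷ xs) f = f x + ∑ xs f

∑-syntax : List A → (A → ℤ) → ℤ
∑-syntax = ∑

infix 5 ∑-syntax
syntax ∑-syntax xs (λ x → e) = ∑[ x ∈ xs ] e

∑-cong : ∀ (xs : List A) {f g} → (∀ x → f x ≡ g x) → ∑ xs f ≡ ∑ xs g
∑-cong []       f≗g = refl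
∑-cong (x ∷ xs) f≗g = cong₂ _+_ (f≗g x) (∑-cong xs f≗g)

∑-cong[mod] : ∀ {m} (xs : List A) {f g} → (∀ x → f x ≡ g x [mod m ]) → ∑ xs f ≡ ∑ xs g [mod m ]
∑-cong[mod] []       f≡g = ≡[mod]-refl
∑-cong[mod] (x ∷ xs) f≡g = +-cong[mod] (f≡g x) (∑-cong[mod] xs f≡g)

∑-0 : ∀ (xs : List A) → ∑[ x ∈ xs ] 0ℤ ≡ 0ℤ
∑-0 []       = refl
∑-0 (x ∷ xs) = trans (ℤ.+-identityˡ _) (∑-0 xs)

∑-++ : ∀ (xs ys : List A) f → ∑ (xs ++ ys) f ≡ ∑ xs f + ∑ ys f
∑-++ []       ys f = sym (ℤ.+-identityˡ _)
∑-++ (x ∷ xs) ys f = trans (cong (_+_ (f x)) (∑-++ xs ys f)) (sym (ℤ.+-assoc (f x) _ _))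

∑-map : ∀ (g : A → B) xs f → ∑ (map g xs) f ≡ ∑[ x ∈ xs ] f (g x)
∑-map g []       f = refl
∑-map g (x ∷ xs) f = cong (_+_ (f (g x))) (∑-map g xs f)

∑-concatMap : ∀ (g : A → List B) xs f → ∑ (concatMap g xs) f ≡ ∑[ x ∈ xs ] ∑ (g x) f
∑-concatMap g []       f = refl
∑-concatMap g (x ∷ xs) f =
  trans (∑-++ (g x) (concatMap g xs) f) (cong (_+_ (∑ (g x) f)) (∑-concatMap g xs f))

∑-+ : ∀ (xs : List A) f g → ∑[ x ∈ xs ] (f x + g x) ≡ ∑ xs f + ∑ xs g
∑-+ []       f g = refl
∑-+ (x ∷ xs) f g = trans (cong (_+_ (f x + g x)) (∑-+ xs f g)) (shuffle (f x) (g x) _ _)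
  where
  shuffle : ∀ a b c d → a + b + (c + d) ≡ a + c + (b + d)
  shuffle = solve-∀

∑-swap : ∀ (xs : List A) (ys : List B) (f : A → B → ℤ) →
         ∑[ x ∈ xs ] ∑[ y ∈ ys ] f x y ≡ ∑[ y ∈ ys ] ∑[ x ∈ xs ] f x y
∑-swap []       ys f = sym (∑-0 ys)
∑-swap (x ∷ xs) ys f =
  trans (cong (_+_ (∑ ys (f x))) (∑-swap xs ys f)) (sym (∑-+ ys (f x) (λ y → ∑[ x′ ∈ xs ] f x′ y)))

*-∑ : ∀ c (xs : List A) f → c * ∑ xs f ≡ ∑[ x ∈ xs ] c * f x
*-∑ c []       f = ℤ.*-zeroʳ c
*-∑ c (x ∷ xs) f = trans (ℤ.*-distribˡ-+ c (f x) _) (cong (_+_ (c * f x)) (*-∑ c xs f))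

infixl 6 _+ᵥ_ _-ᵥ_
infixr 7 _·ᵥ_

_+ᵥ_ _-ᵥ_ : Vec ℤ d → Vec ℤ d → Vec ℤ d
_+ᵥ_ = zipWith _+_
_-ᵥ_ = zipWith _-_

0ᵥ : Vec ℤ d
0ᵥ {d} = replicate d 0ℤ

-- Written as in `frob`, so that frob p ((c , k) ∷ F) reduces to (c , p ·ᵥ k) ∷ frob p F.
_·ᵥ_ : ℕ → Vec ℤ d → Vec ℤ d
n ·ᵥ k = Vec.map (λ x → + n * x) k

+ᵥ-comm : ∀ (k l : Vec ℤ d) → k +ᵥ l ≡ l +ᵥ k
+ᵥ-comm k l = Pointwise-≡⇒≡ (zipWith-comm ℤ.+-comm k l)

+ᵥ-assoc : ∀ (k l m : Vec ℤ d) → (k +ᵥ l) +ᵥ m ≡ k +ᵥ (l +ᵥ m)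
+ᵥ-assoc k l m = Pointwise-≡⇒≡ (zipWith-assoc ℤ.+-assoc k l m)

+ᵥ-identityˡ : ∀ (k : Vec ℤ d) → 0ᵥ +ᵥ k ≡ k
+ᵥ-identityˡ k = Pointwise-≡⇒≡ (zipWith-identityˡ {f = _+_} {e = 0ℤ} ℤ.+-identityˡ k)

k+ᵥl-ᵥk≡l : ∀ (k l : Vec ℤ d) → k +ᵥ l -ᵥ k ≡ l
k+ᵥl-ᵥk≡l Vec.[]      Vec.[]      = refl
k+ᵥl-ᵥk≡l (x Vec.∷ k) (y Vec.∷ l) = cong₂ Vec._∷_ (eq x y) (k+ᵥl-ᵥk≡l k l)
  where
  eq : ∀ x y → x + y - x ≡ y
  eq = solve-∀

k+ᵥ[e-ᵥk]≡e : ∀ (k e : Vec ℤ d) → k +ᵥ (e -ᵥ k) ≡ e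
k+ᵥ[e-ᵥk]≡e Vec.[]      Vec.[]      = refl
k+ᵥ[e-ᵥk]≡e (x Vec.∷ k) (y Vec.∷ e) = cong₂ Vec._∷_ (eq x y) (k+ᵥ[e-ᵥk]≡e k e)
  where
  eq : ∀ x y → x + (y - x) ≡ y
  eq = solve-∀

·ᵥ-zeroˡ : ∀ (k : Vec ℤ d) → 0 ·ᵥ k ≡ 0ᵥ
·ᵥ-zeroˡ Vec.[]      = refl
·ᵥ-zeroˡ (x Vec.∷ k) = cong₂ Vec._∷_ (ℤ.*-zeroˡ x) (·ᵥ-zeroˡ k)

suc-·ᵥ : ∀ n (k : Vec ℤ d) → suc n ·ᵥ k ≡ k +ᵥ n ·ᵥ k
suc-·ᵥ n Vec.[]      = refl
suc-·ᵥ n (x Vec.∷ k) = cong₂ Vec._∷_ (ℤ.suc-* (+ n) x) (suc-·ᵥ n k)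

·ᵥ-injective : ∀ n .{{_ : ℕ.NonZero n}} {k l : Vec ℤ d} → n ·ᵥ k ≡ n ·ᵥ l → k ≡ l
·ᵥ-injective n {Vec.[]}    {Vec.[]}    _  = refl
·ᵥ-injective n {x Vec.∷ k} {y Vec.∷ l} eq =
  cong₂ Vec._∷_ (ℤ.*-cancelˡ-≡ (+ n) x y (∷-injectiveˡ eq)) (·ᵥ-injective n (∷-injectiveʳ eq))

Term : ℕ → Set
Term d = ℤ × Vec ℤ d

module _ {d : ℕ} where

  open ≡.≡-Reasoning

  coeff-∷ : ∀ (t : Term d) F e → coeff (t ∷ F) e ≡ coeff [ t ] e + coeff F e
  coeff-∷ (c , k) F e with ≡-dec ℤ._≟_ k e
  ... | yes _ = cong (_+ coeff F e) (sym (ℤ.+-identityʳ c))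
  ... | no  _ = sym (ℤ.+-identityˡ (coeff F e))

  coeff-∑ : ∀ (F : LPoly d) e → coeff F e ≡ ∑[ t ∈ F ] coeff [ t ] e
  coeff-∑ []      e = refl
  coeff-∑ (t ∷ F) e = trans (coeff-∷ t F e) (cong (_+_ (coeff [ t ] e)) (coeff-∑ F e))

  coeff-++ : ∀ (F G : LPoly d) e → coeff (F ++ G) e ≡ coeff F e + coeff G e
  coeff-++ F G e = begin
    coeff (F ++ G) e                                         ≡⟨ coeff-∑ (F ++ G) e ⟩
    ∑[ t ∈ F ++ G ] coeff [ t ] e                             ≡⟨ ∑-++ F G _ ⟩
    (∑[ t ∈ F ] coeff [ t ] e) + (∑[ t ∈ G ] coeff [ t ] e)
      ≡⟨ cong₂ _+_ (coeff-∑ F e) (coeff-∑ G e) ⟨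
    coeff F e + coeff G e                                    ∎

  coeff-monomial-* : ∀ a c (k e : Vec ℤ d) → coeff [ (a * c , k) ] e ≡ a * coeff [ (c , k) ] e
  coeff-monomial-* a c k e with ≡-dec ℤ._≟_ k e
  ... | yes _ = trans (ℤ.+-identityʳ (a * c)) (cong (a *_) (sym (ℤ.+-identityʳ c)))
  ... | no  _ = sym (ℤ.*-zeroʳ a)

  coeff-monomial-resp : ∀ c {k e k′ e′ : Vec ℤ d} → (k ≡ e → k′ ≡ e′) → (k′ ≡ e′ → k ≡ e) →
                        coeff [ (c , k) ] e ≡ coeff [ (c , k′) ] e′
  coeff-monomial-resp c {k} {e} {k′} {e′} ⇒ ⇐ with ≡-dec ℤ._≟_ k e | ≡-dec ℤ._≟_ k′ e′
  ... | yes _   | yes _     = refl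
  ... | no  _   | no  _     = refl
  ... | yes k≡e | no  k′≢e′ = ⊥-elim (k′≢e′ (⇒ k≡e))
  ... | no  k≢e | yes k′≡e′ = ⊥-elim (k≢e (⇐ k′≡e′))

  coeff-monomial-cong[mod] : ∀ {m c c′} (k e : Vec ℤ d) → c ≡ c′ [mod m ] →
                             coeff [ (c , k) ] e ≡ coeff [ (c′ , k) ] e [mod m ]
  coeff-monomial-cong[mod] k e c≡c′ with ≡-dec ℤ._≟_ k e
  ... | yes _ = +-cong[mod] c≡c′ ≡[mod]-refl
  ... | no  _ = ≡[mod]-refl

  infixl 7 _⊗_

  -- F *L G unfolds to concatMap (λ s → map (s ⊗_) G) F.
  _⊗_ : Term d → Term d → Term d
  (c , k) ⊗ (c′ , k′) = (c * c′ , k +ᵥ k′)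

  ⊗-comm : ∀ (s t : Term d) → s ⊗ t ≡ t ⊗ s
  ⊗-comm (c , k) (c′ , k′) = cong₂ _,_ (ℤ.*-comm c c′) (+ᵥ-comm k k′)

  ⊗-assoc : ∀ (s t u : Term d) → (s ⊗ t) ⊗ u ≡ s ⊗ (t ⊗ u)
  ⊗-assoc (a , k) (b , l) (c , m) = cong₂ _,_ (ℤ.*-assoc a b c) (+ᵥ-assoc k l m)

  ⊗-identityˡ : ∀ (t : Term d) → (1ℤ , 0ᵥ) ⊗ t ≡ t
  ⊗-identityˡ (c , k) = cong₂ _,_ (ℤ.*-identityˡ c) (+ᵥ-identityˡ k)

  ∑-*L : ∀ (F G : LPoly d) f → ∑ (F *L G) f ≡ ∑[ s ∈ F ] ∑[ t ∈ G ] f (s ⊗ t)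
  ∑-*L F G f = trans (∑-concatMap (λ s → map (s ⊗_) G) F f) (∑-cong F (λ s → ∑-map (s ⊗_) G f))

  coeff-*L : ∀ (F G : LPoly d) e → coeff (F *L G) e ≡ ∑[ s ∈ F ] ∑[ t ∈ G ] coeff [ s ⊗ t ] e
  coeff-*L F G e = trans (coeff-∑ (F *L G) e) (∑-*L F G _)

  coeff-monomial-⊗ : ∀ (s t : Term d) e → coeff [ s ⊗ t ] e ≡ proj₁ s * coeff [ t ] (e -ᵥ proj₂ s)
  coeff-monomial-⊗ (c , k) (c′ , k′) e =
    trans (coeff-monomial-* c c′ (k +ᵥ k′) e) (cong (c *_) (coeff-monomial-resp c′ ⇒ ⇐))
    where
    ⇒ : k +ᵥ k′ ≡ e → k′ ≡ e -ᵥ k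
    ⇒ k+k′≡e = trans (sym (k+ᵥl-ᵥk≡l k k′)) (cong (_-ᵥ k) k+k′≡e)
    ⇐ : k′ ≡ e -ᵥ k → k +ᵥ k′ ≡ e
    ⇐ k′≡e-k = trans (cong (k +ᵥ_) k′≡e-k) (k+ᵥ[e-ᵥk]≡e k e)

  coeff-*L-shift : ∀ (F G : LPoly d) e → coeff (F *L G) e ≡ ∑[ s ∈ F ] proj₁ s * coeff G (e -ᵥ proj₂ s)
  coeff-*L-shift F G e = begin
    coeff (F *L G) e
      ≡⟨ coeff-*L F G e ⟩
    ∑[ s ∈ F ] ∑[ t ∈ G ] coeff [ s ⊗ t ] e
      ≡⟨ ∑-cong F (λ s → ∑-cong G (λ t → coeff-monomial-⊗ s t e)) ⟩
    ∑[ s ∈ F ] ∑[ t ∈ G ] proj₁ s * coeff [ t ] (e -ᵥ proj₂ s)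
      ≡⟨ ∑-cong F (λ s → *-∑ (proj₁ s) G _) ⟨
    ∑[ s ∈ F ] proj₁ s * (∑[ t ∈ G ] coeff [ t ] (e -ᵥ proj₂ s))
      ≡⟨ ∑-cong F (λ s → cong (proj₁ s *_) (coeff-∑ G _)) ⟨
    ∑[ s ∈ F ] proj₁ s * coeff G (e -ᵥ proj₂ s)
      ∎

-- Laurent polynomials modulo m

infix 4 _≈_[mod_]

-- The relation F ≈[ m ] G of Defs, as a record so that F and G are inferable from a proof.
record _≈_[mod_] (F G : LPoly d) (m : ℕ) : Set where
  constructor coeffwise
  field coeff-≡[mod] : ∀ e → coeff F e ≡ coeff G e [mod m ]

open _≈_[mod_] public

module _ {m d : ℕ} where

  ≈[]⇒≈[mod] : ∀ {F G : LPoly d} → F ≈[ m ] G → F ≈ G [mod m ]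
  ≈[]⇒≈[mod] F≈G = coeffwise λ e → from∣ (F≈G e)

  ≈[mod]⇒≈[] : ∀ {F G : LPoly d} → F ≈ G [mod m ] → F ≈[ m ] G
  ≈[mod]⇒≈[] F≈G e = to∣ (coeff-≡[mod] F≈G e)

  ≡⇒≈[mod] : ∀ {F G : LPoly d} → F ≡ G → F ≈ G [mod m ]
  ≡⇒≈[mod] refl = coeffwise λ e → ≡[mod]-refl

  ≈[mod]-refl : ∀ {F : LPoly d} → F ≈ F [mod m ]
  ≈[mod]-refl = ≡⇒≈[mod] refl

  ≈[mod]-sym : ∀ {F G : LPoly d} → F ≈ G [mod m ] → G ≈ F [mod m ]
  ≈[mod]-sym F≈G = coeffwise λ e → ≡[mod]-sym (coeff-≡[mod] F≈G e)

  ≈[mod]-trans : ∀ {F G H : LPoly d} → F ≈ G [mod m ] → G ≈ H [mod m ] → F ≈ H [mod m ]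
  ≈[mod]-trans F≈G G≈H = coeffwise λ e → ≡[mod]-trans (coeff-≡[mod] F≈G e) (coeff-≡[mod] G≈H e)

  ≈[mod]-isEquivalence : IsEquivalence (λ (F G : LPoly d) → F ≈ G [mod m ])
  ≈[mod]-isEquivalence = record { refl = ≈[mod]-refl ; sym = ≈[mod]-sym ; trans = ≈[mod]-trans }

  ≈[mod]-setoid : Setoid 0ℓ 0ℓ
  ≈[mod]-setoid = record { isEquivalence = ≈[mod]-isEquivalence }

  ++-comm[mod] : ∀ (F G : LPoly d) → F ++ G ≈ G ++ F [mod m ]
  ++-comm[mod] F G = coeffwise λ e → ≡⇒≡[mod] $
    trans (coeff-++ F G e) (trans (ℤ.+-comm (coeff F e) (coeff G e)) (sym (coeff-++ G F e)))

  ++-cong[mod] : ∀ {F F′ G G′ : LPoly d} → F ≈ F′ [mod m ] → G ≈ G′ [mod m ] → F ++ G ≈ F′ ++ G′ [mod m ]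
  ++-cong[mod] {F} {F′} {G} {G′} F≈F′ G≈G′ = coeffwise λ e → begin
    coeff (F ++ G) e          ≡⟨ coeff-++ F G e ⟩
    coeff F e + coeff G e     ≈⟨ +-cong[mod] (coeff-≡[mod] F≈F′ e) (coeff-≡[mod] G≈G′ e) ⟩
    coeff F′ e + coeff G′ e   ≡⟨ coeff-++ F′ G′ e ⟨
    coeff (F′ ++ G′) e        ∎
    where open import Relation.Binary.Reasoning.Setoid (CommutativeSemiring.setoid (ℤ/ m))

  *L-comm : ∀ (F G : LPoly d) → F *L G ≈ G *L F [mod m ]
  *L-comm F G = coeffwise λ e → ≡⇒≡[mod] $ begin
    coeff (F *L G) e                          ≡⟨ coeff-*L F G e ⟩
    ∑[ s ∈ F ] ∑[ t ∈ G ] coeff [ s ⊗ t ] e    ≡⟨ ∑-swap F G _ ⟩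
    ∑[ t ∈ G ] ∑[ s ∈ F ] coeff [ s ⊗ t ] e
      ≡⟨ ∑-cong G (λ t → ∑-cong F (λ s → cong (λ u → coeff [ u ] e) (⊗-comm s t))) ⟩
    ∑[ t ∈ G ] ∑[ s ∈ F ] coeff [ t ⊗ s ] e    ≡⟨ coeff-*L G F e ⟨
    coeff (G *L F) e                          ∎
    where open ≡.≡-Reasoning

  *L-assoc : ∀ (F G H : LPoly d) → (F *L G) *L H ≈ F *L (G *L H) [mod m ]
  *L-assoc F G H = coeffwise λ e → ≡⇒≡[mod] $ begin
    coeff ((F *L G) *L H) e
      ≡⟨ coeff-*L (F *L G) H e ⟩
    ∑[ v ∈ F *L G ] ∑[ u ∈ H ] coeff [ v ⊗ u ] e
      ≡⟨ ∑-*L F G _ ⟩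
    ∑[ s ∈ F ] ∑[ t ∈ G ] ∑[ u ∈ H ] coeff [ (s ⊗ t) ⊗ u ] e
      ≡⟨ ∑-cong F (λ s → ∑-cong G (λ t → ∑-cong H (λ u → cong (λ v → coeff [ v ] e) (⊗-assoc s t u)))) ⟩
    ∑[ s ∈ F ] ∑[ t ∈ G ] ∑[ u ∈ H ] coeff [ s ⊗ (t ⊗ u) ] e
      ≡⟨ ∑-cong F (λ s → ∑-*L G H _) ⟨
    ∑[ s ∈ F ] ∑[ w ∈ G *L H ] coeff [ s ⊗ w ] e
      ≡⟨ coeff-*L F (G *L H) e ⟨
    coeff (F *L (G *L H)) e
      ∎
    where open ≡.≡-Reasoning

  *L-identityˡ : ∀ (F : LPoly d) → oneL *L F ≈ F [mod m ]
  *L-identityˡ F = coeffwise λ e → ≡⇒≡[mod] $ begin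
    coeff (oneL *L F) e                            ≡⟨ coeff-*L oneL F e ⟩
    (∑[ t ∈ F ] coeff [ (1ℤ , 0ᵥ) ⊗ t ] e) + 0ℤ     ≡⟨ ℤ.+-identityʳ _ ⟩
    ∑[ t ∈ F ] coeff [ (1ℤ , 0ᵥ) ⊗ t ] e
      ≡⟨ ∑-cong F (λ t → cong (λ u → coeff [ u ] e) (⊗-identityˡ t)) ⟩
    ∑[ t ∈ F ] coeff [ t ] e                        ≡⟨ coeff-∑ F e ⟨
    coeff F e                                      ∎
    where open ≡.≡-Reasoning

  *L-distribʳ : ∀ (F G H : LPoly d) → (G ++ H) *L F ≈ (G *L F) ++ (H *L F) [mod m ]
  *L-distribʳ F G H = coeffwise λ e → ≡⇒≡[mod] $ begin
    coeff ((G ++ H) *L F) e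
      ≡⟨ coeff-*L (G ++ H) F e ⟩
    ∑[ s ∈ G ++ H ] ∑[ t ∈ F ] coeff [ s ⊗ t ] e
      ≡⟨ ∑-++ G H _ ⟩
    (∑[ s ∈ G ] ∑[ t ∈ F ] coeff [ s ⊗ t ] e) + (∑[ s ∈ H ] ∑[ t ∈ F ] coeff [ s ⊗ t ] e)
      ≡⟨ cong₂ _+_ (coeff-*L G F e) (coeff-*L H F e) ⟨
    coeff (G *L F) e + coeff (H *L F) e
      ≡⟨ coeff-++ (G *L F) (H *L F) e ⟨
    coeff ((G *L F) ++ (H *L F)) e
      ∎
    where open ≡.≡-Reasoning

  *L-congˡ[mod] : ∀ (F : LPoly d) {G G′} → G ≈ G′ [mod m ] → F *L G ≈ F *L G′ [mod m ]
  *L-congˡ[mod] F {G} {G′} G≈G′ = coeffwise λ e → begin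
    coeff (F *L G) e
      ≡⟨ coeff-*L-shift F G e ⟩
    ∑[ s ∈ F ] proj₁ s * coeff G (e -ᵥ proj₂ s)
      ≈⟨ ∑-cong[mod] F (λ s → *-cong[mod] (≡[mod]-refl {a = proj₁ s}) (coeff-≡[mod] G≈G′ _)) ⟩
    ∑[ s ∈ F ] proj₁ s * coeff G′ (e -ᵥ proj₂ s)
      ≡⟨ coeff-*L-shift F G′ e ⟨
    coeff (F *L G′) e
      ∎
    where open import Relation.Binary.Reasoning.Setoid (CommutativeSemiring.setoid (ℤ/ m))

  *L-cong[mod] : ∀ {F F′ G G′ : LPoly d} → F ≈ F′ [mod m ] → G ≈ G′ [mod m ] → F *L G ≈ F′ *L G′ [mod m ]
  *L-cong[mod] {F} {F′} {G} {G′} F≈F′ G≈G′ = begin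
    F *L G    ≈⟨ *L-congˡ[mod] F G≈G′ ⟩
    F *L G′   ≈⟨ *L-comm F G′ ⟩
    G′ *L F   ≈⟨ *L-congˡ[mod] G′ F≈F′ ⟩
    G′ *L F′  ≈⟨ *L-comm G′ F′ ⟩
    F′ *L G′  ∎
    where open import Relation.Binary.Reasoning.Setoid ≈[mod]-setoid

LPoly_/_ : ℕ → ℕ → CommutativeSemiring 0ℓ 0ℓ
LPoly d / m = record
  { Carrier = LPoly d ; _≈_ = _≈_[mod m ] ; _+_ = _++_ ; _*_ = _*L_ ; 0# = [] ; 1# = oneL
  ; isCommutativeSemiring = isCommutativeSemiringˡ record
    { +-isCommutativeMonoid = isCommutativeMonoidˡ record
      { isSemigroup = record
        { isMagma = record { isEquivalence = ≈[mod]-isEquivalence ; ∙-cong = ++-cong[mod] }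
        ; assoc   = λ F G H → ≡⇒≈[mod] (List.++-assoc F G H) }
      ; identityˡ = λ F → ≈[mod]-refl
      ; comm      = ++-comm[mod] }
    ; *-isCommutativeMonoid = isCommutativeMonoidˡ record
      { isSemigroup = record
        { isMagma = record { isEquivalence = ≈[mod]-isEquivalence ; ∙-cong = *L-cong[mod] }
        ; assoc   = *L-assoc }
      ; identityˡ = *L-identityˡ
      ; comm      = *L-comm }
    ; distribʳ = *L-distribʳ
    ; zeroˡ    = λ F → ≈[mod]-refl } }

-- The Frobenius endomorphism

module _ {d : ℕ} where

  []-^L : ∀ n .{{_ : ℕ.NonZero n}} → [] ^L n ≡ ([] {A = Term d})
  []-^L (suc n) = refl

  monomial-^L : ∀ (c : ℤ) (k : Vec ℤ d) n → [ (c , k) ] ^L n ≡ [ (c ^ n , n ·ᵥ k) ]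
  monomial-^L c k zero    = cong (λ l → [ (1ℤ , l) ]) (sym (·ᵥ-zeroˡ k))
  monomial-^L c k (suc n) = begin
    [ (c , k) ] *L ([ (c , k) ] ^L n)   ≡⟨ cong ([ (c , k) ] *L_) (monomial-^L c k n) ⟩
    [ (c * c ^ n , k +ᵥ n ·ᵥ k) ]       ≡⟨ cong (λ l → [ (c ^ suc n , l) ]) (suc-·ᵥ n k) ⟨
    [ (c ^ suc n , suc n ·ᵥ k) ]        ∎
    where open ≡.≡-Reasoning

  coeff-frob : ∀ p .{{_ : ℕ.NonZero p}} (F : LPoly d) e → coeff (frob p F) (p ·ᵥ e) ≡ coeff F e
  coeff-frob p []            e = refl
  coeff-frob p ((c , k) ∷ F) e = begin
    coeff (frob p ((c , k) ∷ F)) (p ·ᵥ e)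
      ≡⟨ coeff-∷ (c , p ·ᵥ k) (frob p F) (p ·ᵥ e) ⟩
    coeff [ (c , p ·ᵥ k) ] (p ·ᵥ e) + coeff (frob p F) (p ·ᵥ e)
      ≡⟨ cong₂ _+_ (coeff-monomial-resp c {p ·ᵥ k} {p ·ᵥ e} (·ᵥ-injective p) (cong (p ·ᵥ_))) (coeff-frob p F e) ⟩
    coeff [ (c , k) ] e + coeff F e
      ≡⟨ coeff-∷ (c , k) F e ⟨
    coeff ((c , k) ∷ F) e
      ∎
    where open ≡.≡-Reasoning

  frob-injective : ∀ {m} p .{{_ : ℕ.NonZero p}} {F G : LPoly d} →
                   frob p F ≈ frob p G [mod m ] → F ≈ G [mod m ]
  frob-injective p {F} {G} frobF≈frobG = coeffwise λ e →
    ≡.subst₂ (_≡_[mod _ ]) (coeff-frob p F e) (coeff-frob p G e) (coeff-≡[mod] frobF≈frobG (p ·ᵥ e))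

module _ {d p : ℕ} (pr : Prime p) where

  open CommutativeSemiring (LPoly d / p) using (setoid; semiring)
  open import Algebra.Properties.Semiring.Exp semiring renaming (_^_ to _^ₚ_) using ()
  open import Algebra.Properties.Semiring.Mult semiring using () renaming (_×_ to _·_)
  open Characteristic (LPoly d / p) using (freshman's-dream)
  open import Relation.Binary.Reasoning.Setoid setoid

  private
    instance _ = prime⇒nonZero pr

    ^ₚ≡^L : ∀ (F : LPoly d) n → F ^ₚ n ≡ F ^L n
    ^ₚ≡^L F zero    = refl
    ^ₚ≡^L F (suc n) = cong (F *L_) (^ₚ≡^L F n)

    coeff-· : ∀ n (F : LPoly d) e → coeff (n · F) e ≡ + n * coeff F e
    coeff-· zero    F e = sym (ℤ.*-zeroˡ (coeff F e))
    coeff-· (suc n) F e =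
      trans (coeff-++ F (n · F) e)
        (trans (cong (_+_ (coeff F e)) (coeff-· n F e)) (sym (ℤ.suc-* (+ n) (coeff F e))))

    p·1≈0 : p · oneL ≈ [] [mod p ]
    p·1≈0 = coeffwise λ e →
      ≡.subst (_≡ _ [mod p ]) (trans (ℤ.*-comm _ (+ p)) (sym (coeff-· p oneL e))) (*+m≡0[mod] (coeff oneL e))

  frobenius : ∀ (F : LPoly d) → F ^L p ≈ frob p F [mod p ]
  frobenius []            = ≡⇒≈[mod] ([]-^L p)
  frobenius ((c , k) ∷ F) = begin
    ((c , k) ∷ F) ^L p
      ≡⟨ ^ₚ≡^L ([ (c , k) ] ++ F) p ⟨
    ([ (c , k) ] ++ F) ^ₚ p
      ≈⟨ freshman's-dream pr p·1≈0 [ (c , k) ] F ⟩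
    [ (c , k) ] ^ₚ p ++ F ^ₚ p
      ≡⟨ cong₂ _++_ (trans (^ₚ≡^L _ p) (monomial-^L c k p)) (^ₚ≡^L F p) ⟩
    [ (c ^ p , p ·ᵥ k) ] ++ F ^L p
      ≈⟨ ++-cong[mod] (coeffwise λ e → coeff-monomial-cong[mod] (p ·ᵥ k) e (fermat-ℤ pr c)) (frobenius F) ⟩
    frob p ((c , k) ∷ F)
      ∎

  ^L-p≈frob⇒≈ : ∀ {F G : LPoly d} → F ^L p ≈ frob p G [mod p ] → G ≈ F [mod p ]
  ^L-p≈frob⇒≈ {F} F^p≈frobG = frob-injective p (≈[mod]-trans (≈[mod]-sym F^p≈frobG) (frobenius F))

-- Degree bounds

x*p≤k*[1+M]+M⇒x≤M : ∀ {x p k M} → k < p → x ℕ.* p ≤ k ℕ.* suc M ℕ.+ M → x ≤ M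
x*p≤k*[1+M]+M⇒x≤M {x} {p} {k} {M} k<p x*p≤ = ℕ.≤-pred $ ℕ.*-cancelʳ-< p x (suc M) $ begin-strict
  x ℕ.* p                    ≤⟨ x*p≤ ⟩
  k ℕ.* suc M ℕ.+ M          <⟨ ℕ.+-monoʳ-< (k ℕ.* suc M) (ℕ.n<1+n M) ⟩
  k ℕ.* suc M ℕ.+ suc M      ≡⟨ ℕ.+-comm (k ℕ.* suc M) (suc M) ⟩
  suc k ℕ.* suc M            ≤⟨ ℕ.*-monoˡ-≤ (suc M) k<p ⟩
  p ℕ.* suc M                ≡⟨ ℕ.*-comm p (suc M) ⟩
  suc M ℕ.* p                ∎
  where open ℕ.≤-Reasoning

module _ {p d : ℕ} (D : DegreeLike p d) where

  open DegreeLike D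
  open ℕ.≤-Reasoning

  dg-resp[mod] : ∀ {F G : LPoly d} → F ≈ G [mod p ] → dg F ≡ dg G
  dg-resp[mod] F≈G = dg-resp (≈[mod]⇒≈[] F≈G)

  dg-^L-*L : ∀ k (F G : LPoly d) → dg ((F ^L k) *L G) ≤ k ℕ.* dg F ℕ.+ dg G
  dg-^L-*L zero    F G = ℕ.≤-reflexive (dg-resp[mod] (*L-identityˡ G))
  dg-^L-*L (suc k) F G = begin
    dg ((F *L (F ^L k)) *L G)         ≡⟨ dg-resp[mod] (*L-assoc F (F ^L k) G) ⟩
    dg (F *L ((F ^L k) *L G))         ≤⟨ dg-mul F _ ⟩
    dg F ℕ.+ dg ((F ^L k) *L G)       ≤⟨ ℕ.+-monoʳ-≤ (dg F) (dg-^L-*L k F G) ⟩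
    dg F ℕ.+ (k ℕ.* dg F ℕ.+ dg G)    ≡⟨ ℕ.+-assoc (dg F) (k ℕ.* dg F) (dg G) ⟨
    suc k ℕ.* dg F ℕ.+ dg G           ∎

  dg-Λ-^L-*L : ∀ {M k} {F G : LPoly d} → k < p → dg F ≤ suc M → dg G ≤ M → dg (Λ p ((F ^L k) *L G)) ≤ M
  dg-Λ-^L-*L {M} {k} {F} {G} k<p dgF≤1+M dgG≤M = x*p≤k*[1+M]+M⇒x≤M k<p $ begin
    dg (Λ p ((F ^L k) *L G)) ℕ.* p  ≤⟨ dg-Λ ((F ^L k) *L G) ⟩
    dg ((F ^L k) *L G)              ≤⟨ dg-^L-*L k F G ⟩
    k ℕ.* dg F ℕ.+ dg G             ≤⟨ ℕ.+-mono-≤ (ℕ.*-monoʳ-≤ k dgF≤1+M) dgG≤M ⟩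
    k ℕ.* suc M ℕ.+ M               ∎

corollary2p5 : (p : ℕ) → Prime p → (d : ℕ) → (P Q : LPoly d) → (D : DegreeLike p d) →
    ∀ {Pi Qi} → Reachable p P Q Pi Qi →
    (Pi ≈[ p ] P) × (DegreeLike.dg D Qi ≤ (DegreeLike.dg D P ∸ 1) ⊔ DegreeLike.dg D Q)
corollary2p5 p pr d P Q D start = ≈[mod]⇒≈[] (≈[mod]-refl {F = P}) , ℕ.m≤n⊔m (dg P ∸ 1) (dg Q)
  where open DegreeLike D
corollary2p5 p pr d P Q D (stepSub {Pi} {Qi} rr k k<p P̂ Pi^p≈frobP̂) =
  ≈[mod]⇒≈[] P̂≈P , dg-Λ-^L-*L D k<p dgPi≤1+M dgQi≤M
  where
  open DegreeLike D
  M = (dg P ∸ 1) ⊔ dg Q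
  Pi≈P : Pi ≈ P [mod p ]
  Pi≈P = ≈[]⇒≈[mod] (proj₁ (corollary2p5 p pr d P Q D rr))
  dgQi≤M : dg Qi ≤ M
  dgQi≤M = proj₂ (corollary2p5 p pr d P Q D rr)
  P̂≈P : P̂ ≈ P [mod p ]
  P̂≈P = ≈[mod]-trans (^L-p≈frob⇒≈ pr (≈[]⇒≈[mod] Pi^p≈frobP̂)) Pi≈P
  dgPi≤1+M : dg Pi ≤ suc M
  dgPi≤1+M = ℕ.≤-trans (ℕ.≤-reflexive (dg-resp[mod] D Pi≈P))
               (ℕ.≤-trans (ℕ.m≤n+m∸n (dg P) 1) (ℕ.s≤s (ℕ.m≤m⊔n (dg P ∸ 1) (dg Q))))
corollary2p5 p pr d P Q D (stepKeep {Pi} rr k k<p no-lift) =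
  ⊥-elim (no-lift (Pi , ≈[mod]⇒≈[] (frobenius pr Pi)))
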